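{- Let $0<\delta\le 1/8$ with $1/\delta$ an integer, let $A$ be an instance and $A'$ its rounded instance, and let $\mathcal O$ and $\mathcal O'$ be optimal solutions for $A$ and $A'$ respectively. If a solution $SOL$ satisfies $SOL(A')\le(1+k\delta)\mathcal O'(A')$ for some $k>0$, then $SOL(A)\le(1+(2k+4)\delta)\mathcal O(A)$.
   Context: Scheduling without release dates on uniformly related machines, minimizing total weighted completion time. In $A$, job $j$ has size $a_j>0$ and weight $\omega_j>0$ and machine $i$ has speed $v_i>0$. The rounded instance $A'$ has the same jobs and machines, with speed $s_i=(1+\delta)^{\lfloor\log_{1+\delta}v_i\rfloor}$, weight $w_j=(1+\delta)^{\lceil\log_{1+\delta}\omega_j\rceil}$ and size $p_j=(1+\delta)^{\lceil\log_{1+\delta}a_j\rceil}$. A solution is a partition of the jobs among the machines; for an instance $X$, $SOL(X)$ is the total weighted completion time when each machine processes its jobs from time $0$ without idle time in non-increasing order of density (weight/size) with respect to $X$.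
   Formalization: The job sizes $a_j$, weights $\omega_j$, machine speeds $v_i$ and the constant $k$ take only positive rational values. -}

module Defs where

open import Data.Nat as ℕ using (ℕ; zero; suc)
open import Data.Integer as ℤ using (ℤ; +_; -[1+_])
open import Data.Rational using (ℚ; _+_; _*_; _÷_; _/_; _≤_; _<_; 0ℚ; 1ℚ; Positive)
open import Data.Rational.Properties using (_<?_; _≟_; pos⇒nonZero)
open import Data.Fin using (Fin; toℕ)
import Data.Fin as Fin
open import Data.Bool using (Bool; if_then_else_; _∧_; _∨_)
open import Data.Product using (Σ; _×_)
open import Relation.Nullary.Decidable using (⌊_⌋)
open import Relation.Binary.PropositionalEquality using (_≡_)

Σℚ : {n : ℕ} → (Fin n → ℚ) → ℚ
Σℚ {zero}  f = 0ℚ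
Σℚ {suc n} f = f Fin.zero + Σℚ (λ k → f (Fin.suc k))

_^ℕ_ : ℚ → ℕ → ℚ
q ^ℕ zero  = 1ℚ
q ^ℕ suc n = q * (q ^ℕ n)

-- δ = 1/N (so 1/δ = N is an integer).  The rounding base is 1 + δ.

δ : (N : ℕ) → .{{ℕ.NonZero N}} → ℚ
δ N = + 1 / N

-- (1+δ)^e for an integer exponent e.  Note 1 + 1/N = (N+1)/N and
-- (1+δ)^{-1} = N/(N+1).
pow1+δ : (N : ℕ) → .{{ℕ.NonZero N}} → ℤ → ℚ
pow1+δ N (+ e)     = (+ suc N / N) ^ℕ e
pow1+δ N -[1+ e ]  = (+ N / suc N) ^ℕ suc e

-- r = (1+δ)^{⌊log_{1+δ} x⌋}  (the unique power of 1+δ with r ≤ x < (1+δ) r)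
IsRoundDown : (N : ℕ) → .{{ℕ.NonZero N}} → ℚ → ℚ → Set
IsRoundDown N x r =
  Σ ℤ (λ e → (r ≡ pow1+δ N e) × (pow1+δ N e ≤ x) × (x < pow1+δ N (e ℤ.+ + 1)))

-- r = (1+δ)^{⌈log_{1+δ} x⌉}  (the unique power of 1+δ with r/(1+δ) < x ≤ r)
IsRoundUp : (N : ℕ) → .{{ℕ.NonZero N}} → ℚ → ℚ → Set
IsRoundUp N x r =
  Σ ℤ (λ e → (r ≡ pow1+δ N e) × (pow1+δ N (e ℤ.- + 1) < x) × (x ≤ pow1+δ N e))

record Instance (n m : ℕ) : Set where
  field
    size     : Fin n → ℚ
    weight   : Fin n → ℚ
    speed    : Fin m → ℚ
    size>0   : ∀ j → Positive (size j)
    weight>0 : ∀ j → Positive (weight j)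
    speed>0  : ∀ i → Positive (speed i)

open Instance public

IsRounded : (N : ℕ) → .{{ℕ.NonZero N}} → {n m : ℕ} → Instance n m → Instance n m → Set
IsRounded N {n} {m} A A' =
  (∀ i → IsRoundDown N (speed A i) (speed A' i)) ×
  (∀ j → IsRoundUp N (weight A j) (weight A' j)) ×
  (∀ j → IsRoundUp N (size A j) (size A' j))

Solution : ℕ → ℕ → Set
Solution n m = Fin n → Fin m

density : {n m : ℕ} → Instance n m → Fin n → ℚ
density X j = (weight X j ÷ size X j) {{pos⇒nonZero (size X j) {{size>0 X j}}}}

-- k is processed no later than j on a machine ordering its jobs by
-- non-increasing density (ties broken by job index; the total weighted
-- completion time does not depend on the tie-breaking).
runsBefore : {n m : ℕ} → Instance n m → Fin n → Fin n → Bool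
runsBefore X k j =
  ⌊ density X j <? density X k ⌋ ∨
  (⌊ density X k ≟ density X j ⌋ ∧ ⌊ toℕ k ℕ.≤? toℕ j ⌋)

-- completion time of job j under solution σ: the machine σ j starts at 0,
-- has no idle time, and processes its jobs by non-increasing density.
completion : {n m : ℕ} → Instance n m → Solution n m → Fin n → ℚ
completion X σ j =
  (Σℚ (λ k → if ⌊ σ k Fin.≟ σ j ⌋ ∧ runsBefore X k j then size X k else 0ℚ)
    ÷ speed X (σ j)) {{pos⇒nonZero (speed X (σ j)) {{speed>0 X (σ j)}}}}

cost : {n m : ℕ} → Instance n m → Solution n m → ℚ
cost X σ = Σℚ (λ j → weight X j * completion X σ j)

IsOptimal : {n m : ℕ} → Instance n m → Solution n m → Set
IsOptimal X O = ∀ τ → cost X O ≤ cost X τ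

module Submission where

-- Write cost_R(X, σ) for the total weighted completion time of the
-- assignment σ on instance X when each machine processes its jobs in a
-- fixed total order R; it is the double sum over pairs (j, k) with k
-- before j on j's machine of the contribution wⱼ·pₖ/s_{σ j}.
--  * Smith's rule: for a fixed assignment the density order of X
--    minimises cost_R(X, σ) over all total orders R (pairwise exchange).
--  * Rounding moves each of w, p and 1/s up by a factor in [1, 1+δ], so
--    every contribution grows by a factor in [1, (1+δ)³].
-- Combining both (reordering each side into the other instance's density
-- order) gives SOL_σ(A) ≤ SOL_σ(A') ≤ (1+δ)³ SOL_σ(A) for every σ, whence
--   SOL(A) ≤ SOL(A') ≤ (1+kδ) O'(A') ≤ (1+kδ) O(A') ≤ (1+kδ)(1+δ)³ O(A),
-- and (1+kδ)(1+δ)³ ≤ 1 + (2k+4)δ as soon as δ ≤ 1/8.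

open import Defs
open import Data.Nat as ℕ using (ℕ; zero; suc)
open import Data.Integer as ℤ using (+_; -[1+_])
open import Data.Rational
  using (ℚ; _/_; _+_; _*_; _≤_; _<_; Positive; NonZero; 1ℚ; 0ℚ; 1/_; nonNegative; toℚᵘ)
open import Data.Rational.Properties as ℚP
  using (_<?_; _≟_; pos⇒nonZero; toℚᵘ-injective; toℚᵘ-homo-*; toℚᵘ-homo-+; toℚᵘ-fromℚᵘ; toℚᵘ-cancel-≤)
import Data.Rational.Unnormalised as ℚᵘ
import Data.Rational.Unnormalised.Properties as ℚᵘP
open import Data.Rational.Solver using (module +-*-Solver)
open import Data.Fin as Fin using (Fin; toℕ)
import Data.Fin.Properties as FinP
open import Data.Bool using (Bool; true; false; if_then_else_; _∧_; _∨_)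
open import Data.Product using (_×_; _,_; proj₁; proj₂)
open import Data.Sum using (_⊎_; inj₁; inj₂)
open import Data.Empty using (⊥-elim)
open import Relation.Nullary using (yes; no)
open import Relation.Nullary.Decidable using (⌊_⌋; toWitness)
open import Relation.Binary.Definitions using (tri<; tri≈; tri>)
open import Relation.Binary.PropositionalEquality
import Data.Nat.Properties as ℕP
import Data.Integer.Properties as ℤP
import Data.Nat.Tactic.RingSolver as ℕSolver
open import Data.List using (_∷_; [])

0≤pos : ∀ p → .{{Positive p}} → 0ℚ ≤ p
0≤pos p = ℚP.<⇒≤ (ℚP.positive⁻¹ p)

0≤+ : ∀ {a b} → 0ℚ ≤ a → 0ℚ ≤ b → 0ℚ ≤ a + b
0≤+ ha hb = ℚP.+-mono-≤ ha hb

0≤* : ∀ {a b} → 0ℚ ≤ a → 0ℚ ≤ b → 0ℚ ≤ a * b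
0≤* {a} {b} ha hb =
  ℚP.≤-trans (ℚP.≤-reflexive (sym (ℚP.*-zeroʳ a))) (ℚP.*-monoˡ-≤-nonNeg a {{nonNegative ha}} hb)

*-mono-≤ : ∀ {a b c d} → 0ℚ ≤ a → 0ℚ ≤ c → a ≤ b → c ≤ d → a * c ≤ b * d
*-mono-≤ {a} {b} {c} {d} ha hc a≤b c≤d =
  ℚP.≤-trans (ℚP.*-monoʳ-≤-nonNeg c {{nonNegative hc}} a≤b)
             (ℚP.*-monoˡ-≤-nonNeg b {{nonNegative (ℚP.≤-trans ha a≤b)}} c≤d)

*-monoˡ-≤ : ∀ c {a b} → 0ℚ ≤ c → a ≤ b → c * a ≤ c * b
*-monoˡ-≤ c hc = ℚP.*-monoˡ-≤-nonNeg c {{nonNegative hc}}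

*-monoʳ-≤ : ∀ c {a b} → 0ℚ ≤ c → a ≤ b → a * c ≤ b * c
*-monoʳ-≤ c hc = ℚP.*-monoʳ-≤-nonNeg c {{nonNegative hc}}

halve-≤ : ∀ {a b} → a + a ≤ b + b → a ≤ b
halve-≤ {a} {b} h with a ℚP.≤? b
... | yes a≤b = a≤b
... | no a≰b = ⊥-elim (ℚP.<-irrefl refl (ℚP.<-≤-trans (ℚP.+-mono-< b<a b<a) h))
  where b<a = ℚP.≰⇒> a≰b

ite : Bool → ℚ → ℚ
ite b e = if b then e else 0ℚ

0≤ite : ∀ b {e} → 0ℚ ≤ e → 0ℚ ≤ ite b e
0≤ite true h = h
0≤ite false h = ℚP.≤-refl

Σ-cong : ∀ {n} {f g : Fin n → ℚ} → (∀ i → f i ≡ g i) → Σℚ f ≡ Σℚ g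
Σ-cong {zero} h = refl
Σ-cong {suc n} h = cong₂ _+_ (h Fin.zero) (Σ-cong (λ i → h (Fin.suc i)))

Σ-mono : ∀ {n} {f g : Fin n → ℚ} → (∀ i → f i ≤ g i) → Σℚ f ≤ Σℚ g
Σ-mono {zero} h = ℚP.≤-refl
Σ-mono {suc n} h = ℚP.+-mono-≤ (h Fin.zero) (Σ-mono (λ i → h (Fin.suc i)))

0≤Σ : ∀ {n} {f : Fin n → ℚ} → (∀ i → 0ℚ ≤ f i) → 0ℚ ≤ Σℚ f
0≤Σ {zero} h = ℚP.≤-refl
0≤Σ {suc n} h = 0≤+ (h Fin.zero) (0≤Σ (λ i → h (Fin.suc i)))

Σ-zero : ∀ n → Σℚ {n} (λ _ → 0ℚ) ≡ 0ℚ
Σ-zero zero = refl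
Σ-zero (suc n) = trans (ℚP.+-identityˡ _) (Σ-zero n)

Σ-+ : ∀ {n} (f g : Fin n → ℚ) → Σℚ (λ i → f i + g i) ≡ Σℚ f + Σℚ g
Σ-+ {zero} f g = sym (ℚP.+-identityˡ 0ℚ)
Σ-+ {suc n} f g = begin
    (f₀ + g₀) + Σℚ (λ i → f (Fin.suc i) + g (Fin.suc i))
      ≡⟨ cong (λ s → (f₀ + g₀) + s) (Σ-+ (λ i → f (Fin.suc i)) (λ i → g (Fin.suc i))) ⟩
    (f₀ + g₀) + (Σℚ (λ i → f (Fin.suc i)) + Σℚ (λ i → g (Fin.suc i)))
      ≡⟨ interchange f₀ g₀ _ _ ⟩
    (f₀ + Σℚ (λ i → f (Fin.suc i))) + (g₀ + Σℚ (λ i → g (Fin.suc i))) ∎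
  where
  open ≡-Reasoning
  f₀ = f Fin.zero
  g₀ = g Fin.zero
  interchange : ∀ a b c d → (a + b) + (c + d) ≡ (a + c) + (b + d)
  interchange = solve 4 (λ a b c d → (a :+ b) :+ (c :+ d) := (a :+ c) :+ (b :+ d)) refl
    where open +-*-Solver

Σ-*ˡ : ∀ {n} c (f : Fin n → ℚ) → c * Σℚ f ≡ Σℚ (λ i → c * f i)
Σ-*ˡ {zero} c f = ℚP.*-zeroʳ c
Σ-*ˡ {suc n} c f =
  trans (ℚP.*-distribˡ-+ c _ _) (cong (λ s → c * f Fin.zero + s) (Σ-*ˡ c (λ i → f (Fin.suc i))))

Σ-*ʳ : ∀ {n} c (f : Fin n → ℚ) → Σℚ f * c ≡ Σℚ (λ i → f i * c)
Σ-*ʳ c f = trans (ℚP.*-comm _ c) (trans (Σ-*ˡ c f) (Σ-cong (λ i → ℚP.*-comm c (f i))))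

Σ-swap : ∀ {n m} (f : Fin n → Fin m → ℚ) →
  Σℚ (λ i → Σℚ (λ j → f i j)) ≡ Σℚ (λ j → Σℚ (λ i → f i j))
Σ-swap {zero} {m} f = sym (Σ-zero m)
Σ-swap {suc n} f =
  trans (cong (λ s → Σℚ (f Fin.zero) + s) (Σ-swap (λ i → f (Fin.suc i))))
        (sym (Σ-+ (f Fin.zero) (λ j → Σℚ (λ i → f (Fin.suc i) j))))

Σ² : ∀ {n} → (Fin n → Fin n → ℚ) → ℚ
Σ² f = Σℚ (λ j → Σℚ (λ k → f j k))

Σ²-mono : ∀ {n} {f g : Fin n → Fin n → ℚ} → (∀ j k → f j k ≤ g j k) → Σ² f ≤ Σ² g
Σ²-mono h = Σ-mono (λ j → Σ-mono (h j))

Σ²-*ˡ : ∀ {n} c (f : Fin n → Fin n → ℚ) → c * Σ² f ≡ Σ² (λ j k → c * f j k)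
Σ²-*ˡ c f = trans (Σ-*ˡ c (λ j → Σℚ (f j))) (Σ-cong (λ j → Σ-*ˡ c (f j)))

Σ²-symmetrise : ∀ {n} (f : Fin n → Fin n → ℚ) →
  Σ² f + Σ² f ≡ Σ² (λ j k → f j k + f k j)
Σ²-symmetrise f =
  trans (cong (λ s → Σ² f + s) (Σ-swap f))
    (trans (sym (Σ-+ (λ j → Σℚ (f j)) (λ j → Σℚ (λ k → f k j))))
           (Σ-cong (λ j → sym (Σ-+ (f j) (λ k → f k j)))))

module _ {n m : ℕ} (X : Instance n m) where

  invSpeed : Fin m → ℚ
  invSpeed i = (1/ speed X i) {{pos⇒nonZero (speed X i) {{speed>0 X i}}}}

  speed*invSpeed : ∀ i → speed X i * invSpeed i ≡ 1ℚ
  speed*invSpeed i = ℚP.*-inverseʳ (speed X i) {{pos⇒nonZero (speed X i) {{speed>0 X i}}}}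

  0≤weight : ∀ j → 0ℚ ≤ weight X j
  0≤weight j = 0≤pos (weight X j) {{weight>0 X j}}

  0≤size : ∀ j → 0ℚ ≤ size X j
  0≤size j = 0≤pos (size X j) {{size>0 X j}}

  0≤invSpeed : ∀ i → 0ℚ ≤ invSpeed i
  0≤invSpeed i = 0≤pos (invSpeed i) {{ℚP.1/pos⇒pos (speed X i) {{speed>0 X i}}}}

  -- wⱼ·pₖ/s_{σ j}: the share of job k in the weighted completion time of
  -- job j when k runs before j on j's machine.
  contribution : Solution n m → Fin n → Fin n → ℚ
  contribution σ j k = weight X j * (size X k * invSpeed (σ j))

  0≤contribution : ∀ σ j k → 0ℚ ≤ contribution σ j k
  0≤contribution σ j k = 0≤* (0≤weight j) (0≤* (0≤size k) (0≤invSpeed (σ j)))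

  -- k runs no later than j under σ and the order R (R k j: "k before j").
  precedes : Solution n m → (Fin n → Fin n → Bool) → Fin n → Fin n → Bool
  precedes σ R j k = ⌊ σ k Fin.≟ σ j ⌋ ∧ R k j

  costUnder : Solution n m → (Fin n → Fin n → Bool) → ℚ
  costUnder σ R = Σ² (λ j k → ite (precedes σ R j k) (contribution σ j k))

  cost≡costUnder : ∀ σ → cost X σ ≡ costUnder σ (runsBefore X)
  cost≡costUnder σ = Σ-cong (λ j → begin
      weight X j * (Σℚ (load j) * invSpeed (σ j))
        ≡⟨ cong (weight X j *_) (Σ-*ʳ (invSpeed (σ j)) (load j)) ⟩
      weight X j * Σℚ (λ k → load j k * invSpeed (σ j))
        ≡⟨ Σ-*ˡ (weight X j) (λ k → load j k * invSpeed (σ j)) ⟩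
      Σℚ (λ k → weight X j * (load j k * invSpeed (σ j)))
        ≡⟨ Σ-cong (λ k → distribute-ite (precedes σ (runsBefore X) j k)
                                        (weight X j) (size X k) (invSpeed (σ j))) ⟩
      Σℚ (λ k → ite (precedes σ (runsBefore X) j k) (contribution σ j k)) ∎)
    where
    open ≡-Reasoning
    load : Fin n → Fin n → ℚ
    load j k = ite (precedes σ (runsBefore X) j k) (size X k)
    distribute-ite : ∀ b w p c → w * (ite b p * c) ≡ ite b (w * (p * c))
    distribute-ite true w p c = refl
    distribute-ite false w p c = trans (cong (w *_) (ℚP.*-zeroˡ c)) (ℚP.*-zeroʳ w)

  0≤cost : ∀ σ → 0ℚ ≤ cost X σ
  0≤cost σ = subst (0ℚ ≤_) (sym (cost≡costUnder σ))
    (0≤Σ (λ j → 0≤Σ (λ k → 0≤ite (precedes σ (runsBefore X) j k) (0≤contribution σ j k))))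

before : ℚ → ℚ → ℕ → ℕ → Bool
before a b x y = ⌊ b <? a ⌋ ∨ (⌊ a ≟ b ⌋ ∧ ⌊ x ℕ.≤? y ⌋)

before-sound : ∀ a b x y → before a b x y ≡ true → b < a ⊎ (a ≡ b × x ℕ.≤ y)
before-sound a b x y h with b <? a | a ≟ b | x ℕ.≤? y
... | yes b<a | _ | _ = inj₁ b<a
... | no _ | yes a≡b | yes x≤y = inj₂ (a≡b , x≤y)
before-sound a b x y () | no _ | no _ | _
before-sound a b x y () | no _ | yes _ | no _

before-strict : ∀ {a b} x y → b < a → before a b x y ≡ true
before-strict {a} {b} x y b<a with b <? a
... | yes _ = refl
... | no b≮a = ⊥-elim (b≮a b<a)

before-tie : ∀ a {x y} → x ℕ.≤ y → before a a x y ≡ true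
before-tie a {x} {y} x≤y with a <? a | a ≟ a | x ℕ.≤? y
... | yes _ | _ | _ = refl
... | no _ | yes _ | yes _ = refl
... | no _ | no a≢a | _ = ⊥-elim (a≢a refl)
... | no _ | yes _ | no x≰y = ⊥-elim (x≰y x≤y)

before⇒≤ : ∀ a b x y → before a b x y ≡ true → b ≤ a
before⇒≤ a b x y h with before-sound a b x y h
... | inj₁ b<a = ℚP.<⇒≤ b<a
... | inj₂ (a≡b , _) = ℚP.≤-reflexive (sym a≡b)

before-antisym : ∀ a b x y → before a b x y ≡ true → before b a y x ≡ true → x ≡ y
before-antisym a b x y h₁ h₂ with before-sound a b x y h₁ | before-sound b a y x h₂
... | inj₁ b<a | inj₁ a<b = ⊥-elim (ℚP.<-asym b<a a<b)
... | inj₁ b<a | inj₂ (b≡a , _) = ⊥-elim (ℚP.<-irrefl b≡a b<a)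
... | inj₂ (a≡b , _) | inj₁ a<b = ⊥-elim (ℚP.<-irrefl a≡b a<b)
... | inj₂ (_ , x≤y) | inj₂ (_ , y≤x) = ℕP.≤-antisym x≤y y≤x

before-total : ∀ a b x y → before a b x y ≡ true ⊎ before b a y x ≡ true
before-total a b x y with ℚP.<-cmp a b
... | tri< a<b _ _ = inj₂ (before-strict y x a<b)
... | tri> _ _ b<a = inj₁ (before-strict x y b<a)
... | tri≈ _ refl _ with ℕP.≤-total x y
...   | inj₁ x≤y = inj₁ (before-tie a x≤y)
...   | inj₂ y≤x = inj₂ (before-tie a y≤x)

Total : ∀ {n} → (Fin n → Fin n → Bool) → Set
Total R = ∀ k j → R k j ≡ true ⊎ R j k ≡ true

module _ {n m : ℕ} (X : Instance n m) where

  runsBefore-total : Total (runsBefore X)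
  runsBefore-total k j = before-total (density X k) (density X j) (toℕ k) (toℕ j)

  runsBefore-antisym : ∀ k j → runsBefore X k j ≡ true → runsBefore X j k ≡ true → k ≡ j
  runsBefore-antisym k j h₁ h₂ =
    FinP.toℕ-injective (before-antisym (density X k) (density X j) (toℕ k) (toℕ j) h₁ h₂)

  -- Exchange inequality: if k runs before j then wⱼ pₖ ≤ wₖ pⱼ, since
  -- wⱼ/pⱼ ≤ wₖ/pₖ.
  runsBefore-exchange : ∀ k j → runsBefore X k j ≡ true →
    weight X j * size X k ≤ weight X k * size X j
  runsBefore-exchange k j h = begin
      weight X j * size X k               ≡⟨ cong (_* size X k) (weight≡density*size j) ⟩
      (density X j * size X j) * size X k ≡⟨ ℚP.*-assoc (density X j) (size X j) (size X k) ⟩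
      density X j * (size X j * size X k)
        ≤⟨ *-monoʳ-≤ (size X j * size X k) (0≤* (0≤size X j) (0≤size X k))
             (before⇒≤ (density X k) (density X j) (toℕ k) (toℕ j) h) ⟩
      density X k * (size X j * size X k) ≡⟨ rearrange (density X k) (size X j) (size X k) ⟩
      (density X k * size X k) * size X j ≡⟨ cong (_* size X j) (sym (weight≡density*size k)) ⟩
      weight X k * size X j ∎
    where
    open ℚP.≤-Reasoning
    weight≡density*size : ∀ j → weight X j ≡ density X j * size X j
    weight≡density*size j = begin-equality
      weight X j                         ≡⟨ sym (ℚP.*-identityʳ (weight X j)) ⟩
      weight X j * 1ℚ                    ≡⟨ cong (weight X j *_) (sym (ℚP.*-inverseˡ (size X j))) ⟩
      weight X j * (1/ size X j * size X j) ≡⟨ sym (ℚP.*-assoc (weight X j) (1/ size X j) (size X j)) ⟩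
      density X j * size X j ∎
      where instance
        size≢0 : NonZero (size X j)
        size≢0 = pos⇒nonZero (size X j) {{size>0 X j}}
    rearrange : ∀ a b c → a * (b * c) ≡ (a * c) * b
    rearrange = solve 3 (λ a b c → a :* (b :* c) := (a :* c) :* b) refl
      where open +-*-Solver

-- Smith's rule: the density order minimises the cost of an assignment

+0≤0+ : ∀ {a b} → a ≤ b → a + 0ℚ ≤ 0ℚ + b
+0≤0+ {a} {b} a≤b =
  subst₂ _≤_ (sym (ℚP.+-identityʳ a)) (sym (ℚP.+-identityˡ b)) a≤b

0+≤+0 : ∀ {a b} → a ≤ b → 0ℚ + a ≤ b + 0ℚ
0+≤+0 {a} {b} a≤b =
  subst₂ _≤_ (sym (ℚP.+-identityˡ a)) (sym (ℚP.+-identityʳ b)) a≤b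

-- One unordered pair {j, k} of jobs on a common machine: e₁ is k's share
-- in j's completion time, e₂ the converse; d₁, d₂ (resp. r₁, r₂) say
-- whether the density order (resp. the order R) runs k before j, j before k.
-- The density order only pays the smaller share (both only if j = k),
-- while the total order R pays at least one of them.
pair-exchange : ∀ d₁ d₂ r₁ r₂ {e₁ e₂} → 0ℚ ≤ e₁ → 0ℚ ≤ e₂ →
  r₁ ≡ true ⊎ r₂ ≡ true →
  (d₁ ≡ true → e₁ ≤ e₂) → (d₂ ≡ true → e₂ ≤ e₁) →
  (d₁ ≡ true → d₂ ≡ true → r₁ ≡ true × r₂ ≡ true) →
  ite d₁ e₁ + ite d₂ e₂ ≤ ite r₁ e₁ + ite r₂ e₂
pair-exchange true true r₁ r₂ _ _ _ _ _ both with both refl refl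
... | refl , refl = ℚP.≤-refl
pair-exchange true false true r₂ {e₁} _ h₂ _ _ _ _ = ℚP.+-monoʳ-≤ e₁ (0≤ite r₂ h₂)
pair-exchange true false false true _ _ _ e₁≤e₂ _ _ = +0≤0+ (e₁≤e₂ refl)
pair-exchange true false false false _ _ (inj₁ ()) _ _ _
pair-exchange true false false false _ _ (inj₂ ()) _ _ _
pair-exchange false true r₁ true {e₂ = e₂} h₁ _ _ _ _ _ = ℚP.+-monoˡ-≤ e₂ (0≤ite r₁ h₁)
pair-exchange false true true false _ _ _ _ e₂≤e₁ _ = 0+≤+0 (e₂≤e₁ refl)
pair-exchange false true false false _ _ (inj₁ ()) _ _ _
pair-exchange false true false false _ _ (inj₂ ()) _ _ _
pair-exchange false false r₁ r₂ h₁ h₂ _ _ _ _ = 0≤+ (0≤ite r₁ h₁) (0≤ite r₂ h₂)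

-- Jobs on different machines contribute nothing to each other.
guarded-exchange : ∀ s {d₁ d₂ r₁ r₂ e₁ e₂} →
  (s ≡ true → ite d₁ e₁ + ite d₂ e₂ ≤ ite r₁ e₁ + ite r₂ e₂) →
  ite (s ∧ d₁) e₁ + ite (s ∧ d₂) e₂ ≤ ite (s ∧ r₁) e₁ + ite (s ∧ r₂) e₂
guarded-exchange true h = h refl
guarded-exchange false h = ℚP.≤-refl

≟-sym : ∀ {m} (a b : Fin m) → ⌊ b Fin.≟ a ⌋ ≡ ⌊ a Fin.≟ b ⌋
≟-sym a b with a Fin.≟ b | b Fin.≟ a
... | yes _ | yes _ = refl
... | no _ | no _ = refl
... | yes a≡b | no b≢a = ⊥-elim (b≢a (sym a≡b))
... | no a≢b | yes b≡a = ⊥-elim (a≢b (sym b≡a))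

≟⇒≡ : ∀ {m} (a b : Fin m) → ⌊ a Fin.≟ b ⌋ ≡ true → a ≡ b
≟⇒≡ a b h with a Fin.≟ b
... | yes a≡b = a≡b
≟⇒≡ a b () | no _

module _ {n m : ℕ} (X : Instance n m) (σ : Solution n m) where

  private
    term : (Fin n → Fin n → Bool) → Fin n → Fin n → ℚ
    term R j k = ite (precedes X σ R j k) (contribution X σ j k)

  contribution-exchange : ∀ j k → σ k ≡ σ j → runsBefore X k j ≡ true →
    contribution X σ j k ≤ contribution X σ k j
  contribution-exchange j k same k-first = begin
      weight X j * (size X k * c)  ≡⟨ sym (ℚP.*-assoc (weight X j) (size X k) c) ⟩
      (weight X j * size X k) * c  ≤⟨ *-monoʳ-≤ c (0≤invSpeed X (σ j)) (runsBefore-exchange X k j k-first) ⟩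
      (weight X k * size X j) * c  ≡⟨ ℚP.*-assoc (weight X k) (size X j) c ⟩
      weight X k * (size X j * c)  ≡⟨ cong (λ i → weight X k * (size X j * invSpeed X i)) (sym same) ⟩
      contribution X σ k j ∎
    where
    open ℚP.≤-Reasoning
    c = invSpeed X (σ j)

  pair-bound : (R : Fin n → Fin n → Bool) → Total R → ∀ j k →
    term (runsBefore X) j k + term (runsBefore X) k j ≤ term R j k + term R k j
  pair-bound R total j k rewrite ≟-sym (σ k) (σ j) =
    guarded-exchange ⌊ σ k Fin.≟ σ j ⌋ λ same →
      pair-exchange (runsBefore X k j) (runsBefore X j k) (R k j) (R j k)
        (0≤contribution X σ j k) (0≤contribution X σ k j) (total k j)
        (contribution-exchange j k (≟⇒≡ (σ k) (σ j) same))
        (contribution-exchange k j (sym (≟⇒≡ (σ k) (σ j) same)))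
        (λ d₁ d₂ → both-directions (runsBefore-antisym X k j d₁ d₂))
    where
    both-directions : k ≡ j → R k j ≡ true × R j k ≡ true
    both-directions refl with total k k
    ... | inj₁ h = h , h
    ... | inj₂ h = h , h

  smith : (R : Fin n → Fin n → Bool) → Total R →
    costUnder X σ (runsBefore X) ≤ costUnder X σ R
  smith R total = halve-≤ (begin
      Σ² (term D) + Σ² (term D)                    ≡⟨ Σ²-symmetrise (term D) ⟩
      Σ² (λ j k → term D j k + term D k j)         ≤⟨ Σ²-mono (pair-bound R total) ⟩
      Σ² (λ j k → term R j k + term R k j)         ≡⟨ sym (Σ²-symmetrise (term R)) ⟩
      Σ² (term R) + Σ² (term R) ∎)
    where
    open ℚP.≤-Reasoning
    D = runsBefore X

contribution-mono : ∀ {w w′ p p′ i i′} → 0ℚ ≤ w → 0ℚ ≤ p → 0ℚ ≤ i →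
  w ≤ w′ → p ≤ p′ → i ≤ i′ → w * (p * i) ≤ w′ * (p′ * i′)
contribution-mono 0≤w 0≤p 0≤i w≤w′ p≤p′ i≤i′ =
  *-mono-≤ 0≤w (0≤* 0≤p 0≤i) w≤w′ (*-mono-≤ 0≤p 0≤i p≤p′ i≤i′)

cube : ℚ → ℚ
cube c = c * (c * c)

contribution-scale : ∀ c w p i → (c * w) * ((c * p) * (c * i)) ≡ cube c * (w * (p * i))
contribution-scale = solve 4 (λ c w p i →
  (c :* w) :* ((c :* p) :* (c :* i)) := (c :* (c :* c)) :* (w :* (p :* i))) refl
  where open +-*-Solver

module _ {n m : ℕ} (X Y : Instance n m) (σ : Solution n m) (R : Fin n → Fin n → Bool) where

  costUnder-mono : (∀ j k → contribution X σ j k ≤ contribution Y σ j k) →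
    costUnder X σ R ≤ costUnder Y σ R
  costUnder-mono h = Σ²-mono termwise
    where
    termwise : ∀ j k → ite (precedes X σ R j k) (contribution X σ j k)
                     ≤ ite (precedes Y σ R j k) (contribution Y σ j k)
    termwise j k with precedes X σ R j k
    ... | true = h j k
    ... | false = ℚP.≤-refl

  costUnder-scale : ∀ c → (∀ j k → contribution Y σ j k ≤ c * contribution X σ j k) →
    costUnder Y σ R ≤ c * costUnder X σ R
  costUnder-scale c h = begin
      costUnder Y σ R                                                 ≤⟨ Σ²-mono termwise ⟩
      Σ² (λ j k → c * ite (precedes X σ R j k) (contribution X σ j k)) ≡⟨ sym (Σ²-*ˡ c (λ j k → ite (precedes X σ R j k) (contribution X σ j k))) ⟩
      c * costUnder X σ R ∎
    where
    open ℚP.≤-Reasoning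
    termwise : ∀ j k → ite (precedes Y σ R j k) (contribution Y σ j k)
                     ≤ c * ite (precedes X σ R j k) (contribution X σ j k)
    termwise j k with precedes X σ R j k
    ... | true = h j k
    ... | false = ℚP.≤-reflexive (sym (ℚP.*-zeroʳ c))

-- Rounding to powers of 1 + δ

reciprocal-≤ : ∀ a b {a⁻¹ b⁻¹} c → a * a⁻¹ ≡ 1ℚ → b * b⁻¹ ≡ 1ℚ →
  0ℚ ≤ a⁻¹ → 0ℚ ≤ b⁻¹ → a ≤ c * b → b⁻¹ ≤ c * a⁻¹
reciprocal-≤ a b {a⁻¹} {b⁻¹} c aa⁻¹ bb⁻¹ 0≤a⁻¹ 0≤b⁻¹ a≤cb = begin
    b⁻¹                      ≡⟨ sym (ℚP.*-identityˡ b⁻¹) ⟩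
    1ℚ * b⁻¹                 ≡⟨ cong (_* b⁻¹) (sym aa⁻¹) ⟩
    (a * a⁻¹) * b⁻¹          ≡⟨ reorder₁ a a⁻¹ b⁻¹ ⟩
    (a * b⁻¹) * a⁻¹          ≤⟨ *-monoʳ-≤ a⁻¹ 0≤a⁻¹ (*-monoʳ-≤ b⁻¹ 0≤b⁻¹ a≤cb) ⟩
    ((c * b) * b⁻¹) * a⁻¹    ≡⟨ reorder₂ c b b⁻¹ a⁻¹ ⟩
    c * ((b * b⁻¹) * a⁻¹)    ≡⟨ cong (λ x → c * (x * a⁻¹)) bb⁻¹ ⟩
    c * (1ℚ * a⁻¹)           ≡⟨ cong (c *_) (ℚP.*-identityˡ a⁻¹) ⟩
    c * a⁻¹ ∎
  where
  open ℚP.≤-Reasoning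
  open +-*-Solver
  reorder₁ : ∀ x y z → (x * y) * z ≡ (x * z) * y
  reorder₁ = solve 3 (λ x y z → (x :* y) :* z := (x :* z) :* y) refl
  reorder₂ : ∀ w x y z → ((w * x) * y) * z ≡ w * ((x * y) * z)
  reorder₂ = solve 4 (λ w x y z → ((w :* x) :* y) :* z := w :* ((x :* y) :* z)) refl

/-as-ℚᵘ : ∀ a b → toℚᵘ (+ a / suc b) ℚᵘ.≃ ℚᵘ.mkℚᵘ (+ a) b
/-as-ℚᵘ a b = toℚᵘ-fromℚᵘ (ℚᵘ.mkℚᵘ (+ a) b)

1+δ≡ : (N : ℕ) → .{{_ : ℕ.NonZero N}} → 1ℚ + δ N ≡ + suc N / N
1+δ≡ (suc n) = toℚᵘ-injective (begin
    toℚᵘ (1ℚ + δ (suc n))            ≈⟨ toℚᵘ-homo-+ 1ℚ (δ (suc n)) ⟩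
    toℚᵘ 1ℚ ℚᵘ.+ toℚᵘ (δ (suc n))    ≈⟨ ℚᵘP.+-congʳ (toℚᵘ 1ℚ) (/-as-ℚᵘ 1 n) ⟩
    toℚᵘ 1ℚ ℚᵘ.+ ℚᵘ.mkℚᵘ (+ 1) n     ≈⟨ ℚᵘ.*≡* (cong +_ (ℕSolver.solve (n ∷ []))) ⟩
    ℚᵘ.mkℚᵘ (+ suc (suc n)) n        ≈⟨ ℚᵘP.≃-sym (/-as-ℚᵘ (suc (suc n)) n) ⟩
    toℚᵘ (+ suc (suc n) / suc n) ∎)
  where open ℚᵘP.≃-Reasoning

/-inverse : (N : ℕ) → .{{_ : ℕ.NonZero N}} → (+ suc N / N) * (+ N / suc N) ≡ 1ℚ
/-inverse (suc n) = toℚᵘ-injective (begin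
    toℚᵘ ((+ suc (suc n) / suc n) * (+ suc n / suc (suc n)))
      ≈⟨ toℚᵘ-homo-* (+ suc (suc n) / suc n) (+ suc n / suc (suc n)) ⟩
    toℚᵘ (+ suc (suc n) / suc n) ℚᵘ.* toℚᵘ (+ suc n / suc (suc n))
      ≈⟨ ℚᵘP.*-cong (/-as-ℚᵘ (suc (suc n)) n) (/-as-ℚᵘ (suc n) (suc n)) ⟩
    ℚᵘ.mkℚᵘ (+ suc (suc n)) n ℚᵘ.* ℚᵘ.mkℚᵘ (+ suc n) (suc n)
      ≈⟨ ℚᵘ.*≡* (cong +_ (ℕSolver.solve (n ∷ []))) ⟩
    toℚᵘ 1ℚ ∎)
  where open ℚᵘP.≃-Reasoning

δ≤1/8 : (N : ℕ) → .{{_ : ℕ.NonZero N}} → 8 ℕ.≤ N → δ N ≤ + 1 / 8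
δ≤1/8 (suc n) 8≤N = toℚᵘ-cancel-≤
  (ℚᵘP.≤-respʳ-≃ (ℚᵘP.≃-sym (/-as-ℚᵘ 1 7)) (ℚᵘP.≤-respˡ-≃ (ℚᵘP.≃-sym (/-as-ℚᵘ 1 n))
    (ℚᵘ.*≤* (ℤ.+≤+ (ℕP.≤-trans 8≤N (ℕP.≤-reflexive (sym (ℕP.*-identityˡ _))))))))

0≤δ : (N : ℕ) → .{{_ : ℕ.NonZero N}} → 0ℚ ≤ δ N
0≤δ N = ℚP.nonNegative⁻¹ (δ N) {{ℚP.normalize-nonNeg 1 N}}

module _ (N : ℕ) .{{_ : ℕ.NonZero N}} where

  private
    ρ : ℚ
    ρ = 1ℚ + δ N

  pow-suc : ∀ e → pow1+δ N (e ℤ.+ + 1) ≡ ρ * pow1+δ N e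
  pow-suc (+ k) = begin
      (+ suc N / N) ^ℕ (k ℕ.+ 1)       ≡⟨ cong ((+ suc N / N) ^ℕ_) (ℕP.+-comm k 1) ⟩
      (+ suc N / N) * (+ suc N / N) ^ℕ k ≡⟨ cong (_* ((+ suc N / N) ^ℕ k)) (sym (1+δ≡ N)) ⟩
      ρ * pow1+δ N (+ k) ∎
    where open ≡-Reasoning
  pow-suc -[1+ k ] = begin
      pow1+δ N (-[1+ k ] ℤ.+ + 1)                  ≡⟨ sym (ℚP.*-identityˡ _) ⟩
      1ℚ * pow1+δ N (-[1+ k ] ℤ.+ + 1)             ≡⟨ cong (_* pow1+δ N (-[1+ k ] ℤ.+ + 1)) (sym (/-inverse N)) ⟩
      ((+ suc N / N) * r) * pow1+δ N (-[1+ k ] ℤ.+ + 1)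
                                                   ≡⟨ ℚP.*-assoc (+ suc N / N) r _ ⟩
      (+ suc N / N) * (r * pow1+δ N (-[1+ k ] ℤ.+ + 1))
                                                   ≡⟨ cong₂ _*_ (sym (1+δ≡ N)) (peel k) ⟩
      ρ * pow1+δ N -[1+ k ] ∎
    where
    open ≡-Reasoning
    r = + N / suc N
    peel : ∀ k → r * pow1+δ N (-[1+ k ] ℤ.+ + 1) ≡ pow1+δ N -[1+ k ]
    peel zero = refl
    peel (suc k) = refl

  pow-pred : ∀ e → pow1+δ N e ≡ ρ * pow1+δ N (e ℤ.- + 1)
  pow-pred e = trans (cong (pow1+δ N) (sym e-1+1≡e)) (pow-suc (e ℤ.- + 1))
    where
    e-1+1≡e : (e ℤ.- + 1) ℤ.+ + 1 ≡ e
    e-1+1≡e = trans (ℤP.+-assoc e (ℤ.- + 1) (+ 1)) (ℤP.+-identityʳ e)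

  roundUp-bounds : ∀ {x r} → IsRoundUp N x r → x ≤ r × r ≤ ρ * x
  roundUp-bounds (e , refl , below , above) =
    above , ℚP.≤-trans (ℚP.≤-reflexive (pow-pred e)) (*-monoˡ-≤ ρ 0≤ρ (ℚP.<⇒≤ below))
    where 0≤ρ = 0≤+ (0≤pos 1ℚ) (0≤δ N)

  roundDown-bounds : ∀ {x r} → IsRoundDown N x r → r ≤ x × x ≤ ρ * r
  roundDown-bounds (e , refl , below , above) =
    below , ℚP.≤-trans (ℚP.<⇒≤ above) (ℚP.≤-reflexive (pow-suc e))

  module _ {n m : ℕ} (A A′ : Instance n m) (rounded : IsRounded N A A′) where

    weight-rounded : ∀ j → weight A j ≤ weight A′ j × weight A′ j ≤ ρ * weight A j
    weight-rounded j = roundUp-bounds (proj₁ (proj₂ rounded) j)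

    size-rounded : ∀ j → size A j ≤ size A′ j × size A′ j ≤ ρ * size A j
    size-rounded j = roundUp-bounds (proj₂ (proj₂ rounded) j)

    -- Speeds are rounded down, so inverse speeds go up.
    invSpeed-rounded : ∀ i →
      invSpeed A i ≤ invSpeed A′ i × invSpeed A′ i ≤ ρ * invSpeed A i
    invSpeed-rounded i =
      ℚP.≤-trans (reciprocal-≤ (speed A′ i) (speed A i) 1ℚ (speed*invSpeed A′ i) (speed*invSpeed A i)
                   (0≤invSpeed A′ i) (0≤invSpeed A i)
                   (ℚP.≤-trans s′≤v (ℚP.≤-reflexive (sym (ℚP.*-identityˡ _)))))
                 (ℚP.≤-reflexive (ℚP.*-identityˡ _)) ,
      reciprocal-≤ (speed A i) (speed A′ i) ρ (speed*invSpeed A i) (speed*invSpeed A′ i)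
        (0≤invSpeed A i) (0≤invSpeed A′ i) v≤ρs′
      where
      s′≤v = proj₁ (roundDown-bounds (proj₁ rounded i))
      v≤ρs′ = proj₂ (roundDown-bounds (proj₁ rounded i))

    contribution-rounded : ∀ σ j k →
      contribution A σ j k ≤ contribution A′ σ j k ×
      contribution A′ σ j k ≤ cube ρ * contribution A σ j k
    contribution-rounded σ j k =
      contribution-mono (0≤weight A j) (0≤size A k) (0≤invSpeed A (σ j))
        (proj₁ (weight-rounded j)) (proj₁ (size-rounded k)) (proj₁ (invSpeed-rounded (σ j))) ,
      ℚP.≤-trans
        (contribution-mono (0≤weight A′ j) (0≤size A′ k) (0≤invSpeed A′ (σ j))
          (proj₂ (weight-rounded j)) (proj₂ (size-rounded k)) (proj₂ (invSpeed-rounded (σ j))))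
        (ℚP.≤-reflexive (contribution-scale ρ (weight A j) (size A k) (invSpeed A (σ j))))

    -- Rounding changes the cost of every assignment by a factor between 1
    -- and (1+δ)³: reorder into the other instance's density order (Smith's
    -- rule), then compare contributions.
    cost-rounded-below : ∀ σ → cost A σ ≤ cost A′ σ
    cost-rounded-below σ = begin
      cost A σ                         ≡⟨ cost≡costUnder A σ ⟩
      costUnder A σ (runsBefore A)     ≤⟨ smith A σ (runsBefore A′) (runsBefore-total A′) ⟩
      costUnder A σ (runsBefore A′)
        ≤⟨ costUnder-mono A A′ σ (runsBefore A′) (λ j k → proj₁ (contribution-rounded σ j k)) ⟩
      costUnder A′ σ (runsBefore A′)   ≡⟨ sym (cost≡costUnder A′ σ) ⟩
      cost A′ σ ∎
      where open ℚP.≤-Reasoning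

    cost-rounded-above : ∀ σ → cost A′ σ ≤ cube ρ * cost A σ
    cost-rounded-above σ = begin
      cost A′ σ                        ≡⟨ cost≡costUnder A′ σ ⟩
      costUnder A′ σ (runsBefore A′)   ≤⟨ smith A′ σ (runsBefore A) (runsBefore-total A) ⟩
      costUnder A′ σ (runsBefore A)
        ≤⟨ costUnder-scale A A′ σ (runsBefore A) (cube ρ) (λ j k → proj₂ (contribution-rounded σ j k)) ⟩
      cube ρ * costUnder A σ (runsBefore A) ≡⟨ cong (cube ρ *_) (sym (cost≡costUnder A σ)) ⟩
      cube ρ * cost A σ ∎
      where open ℚP.≤-Reasoning

cube-mono : ∀ {x y} → 0ℚ ≤ x → x ≤ y → cube x ≤ cube y
cube-mono 0≤x x≤y = *-mono-≤ 0≤x (0≤* 0≤x 0≤x) x≤y (*-mono-≤ 0≤x 0≤x x≤y x≤y)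

module _ {d : ℚ} (0≤d : 0ℚ ≤ d) (d≤⅛ : d ≤ + 1 / 8) where

  private
    ⅛ : ℚ
    ⅛ = + 1 / 8

  cube-≤-linear : cube (1ℚ + d) ≤ 1ℚ + d * (+ 4 / 1)
  cube-≤-linear = begin
      cube (1ℚ + d)                            ≡⟨ expand d ⟩
      1ℚ + d * ((+ 3 / 1) + (+ 3 / 1) * d + d * d)
        ≤⟨ ℚP.+-monoʳ-≤ 1ℚ (*-monoˡ-≤ d 0≤d (ℚP.≤-trans coefficient≤ at-⅛)) ⟩
      1ℚ + d * (+ 4 / 1) ∎
    where
    open ℚP.≤-Reasoning
    expand : ∀ x → cube (1ℚ + x) ≡ 1ℚ + x * ((+ 3 / 1) + (+ 3 / 1) * x + x * x)
    expand = solve 1 (λ x → (con 1ℚ :+ x) :* ((con 1ℚ :+ x) :* (con 1ℚ :+ x))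
      := con 1ℚ :+ x :* (con (+ 3 / 1) :+ con (+ 3 / 1) :* x :+ x :* x)) refl
      where open +-*-Solver
    coefficient≤ : (+ 3 / 1) + (+ 3 / 1) * d + d * d ≤ (+ 3 / 1) + (+ 3 / 1) * ⅛ + ⅛ * ⅛
    coefficient≤ = ℚP.+-mono-≤ (ℚP.+-monoʳ-≤ (+ 3 / 1) (*-monoˡ-≤ (+ 3 / 1) (0≤pos (+ 3 / 1)) d≤⅛))
                               (*-mono-≤ 0≤d 0≤d d≤⅛ d≤⅛)
    at-⅛ : (+ 3 / 1) + (+ 3 / 1) * ⅛ + ⅛ * ⅛ ≤ + 4 / 1
    at-⅛ = toWitness {a? = (+ 3 / 1) + (+ 3 / 1) * ⅛ + ⅛ * ⅛ ℚP.≤? + 4 / 1} _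

  -- (1+d)³ ≤ (9/8)³ ≤ 2.
  cube-≤-2 : cube (1ℚ + d) ≤ + 2 / 1
  cube-≤-2 = ℚP.≤-trans (cube-mono (0≤+ (0≤pos 1ℚ) 0≤d) (ℚP.+-monoʳ-≤ 1ℚ d≤⅛)) at-⅛
    where
    at-⅛ : cube (1ℚ + ⅛) ≤ + 2 / 1
    at-⅛ = toWitness {a? = cube (1ℚ + ⅛) ℚP.≤? + 2 / 1} _

  rounding-factor : ∀ k → 0ℚ ≤ k →
    (1ℚ + k * d) * cube (1ℚ + d) ≤ 1ℚ + ((+ 2 / 1) * k + (+ 4 / 1)) * d
  rounding-factor k 0≤k = begin
      (1ℚ + k * d) * cube (1ℚ + d)              ≡⟨ ℚP.*-distribʳ-+ (cube (1ℚ + d)) 1ℚ (k * d) ⟩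
      1ℚ * cube (1ℚ + d) + k * d * cube (1ℚ + d)
        ≤⟨ ℚP.+-mono-≤ (ℚP.≤-trans (ℚP.≤-reflexive (ℚP.*-identityˡ _)) cube-≤-linear)
                       (*-monoˡ-≤ (k * d) (0≤* 0≤k 0≤d) cube-≤-2) ⟩
      (1ℚ + d * (+ 4 / 1)) + k * d * (+ 2 / 1) ≡⟨ collect k d ⟩
      1ℚ + ((+ 2 / 1) * k + (+ 4 / 1)) * d ∎
    where
    open ℚP.≤-Reasoning
    collect : ∀ k d → (1ℚ + d * (+ 4 / 1)) + k * d * (+ 2 / 1) ≡ 1ℚ + ((+ 2 / 1) * k + (+ 4 / 1)) * d
    collect = solve 2 (λ k d → (con 1ℚ :+ d :* con (+ 4 / 1)) :+ k :* d :* con (+ 2 / 1)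
      := con 1ℚ :+ (con (+ 2 / 1) :* k :+ con (+ 4 / 1)) :* d) refl
      where open +-*-Solver

mainTheorem5 : (N : ℕ) → .{{_ : ℕ.NonZero N}} → 8 ℕ.≤ N →
    {n m : ℕ} (A A' : Instance n m) → IsRounded N A A' →
    (O O' : Solution n m) → IsOptimal A O → IsOptimal A' O' →
    (sol : Solution n m) (k : ℚ) → Positive k →
    cost A' sol ≤ (1ℚ + k * δ N) * cost A' O' →
    cost A sol ≤ (1ℚ + ((+ 2 / 1) * k + (+ 4 / 1)) * δ N) * cost A O
mainTheorem5 N 8≤N A A' rounded O O' O-opt O'-opt sol k k>0 sol-approx = begin
    cost A sol                ≤⟨ cost-rounded-below N A A' rounded sol ⟩
    cost A' sol               ≤⟨ sol-approx ⟩
    a * cost A' O'            ≤⟨ *-monoˡ-≤ a 0≤a (O'-opt O) ⟩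
    a * cost A' O             ≤⟨ *-monoˡ-≤ a 0≤a (cost-rounded-above N A A' rounded O) ⟩
    a * (cube ρ * cost A O)   ≡⟨ sym (ℚP.*-assoc a (cube ρ) (cost A O)) ⟩
    (a * cube ρ) * cost A O
      ≤⟨ *-monoʳ-≤ (cost A O) (0≤cost A O) (rounding-factor (0≤δ N) (δ≤1/8 N 8≤N) k 0≤k) ⟩
    (1ℚ + ((+ 2 / 1) * k + (+ 4 / 1)) * δ N) * cost A O ∎
  where
  open ℚP.≤-Reasoning
  ρ = 1ℚ + δ N
  a = 1ℚ + k * δ N
  0≤k = 0≤pos k {{k>0}}
  0≤a = 0≤+ (0≤pos 1ℚ) (0≤* 0≤k (0≤δ N))
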